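{- Let $\mathbf{B}$ be a topological Boolean algebra, $\nabla$ an open filter and $\Delta$ a closed ideal of $\mathbf{B}$, and $\mathbf{T}=Tw(\mathbf{B},\nabla,\Delta)$. Then $\Gamma(\mathbf{T})\subseteq\Lambda(\mathbf{B},\nabla)$ if and only if $\mathsf{G}_2(\mathbf{T})$ is closed under the operation $\to_{\mathcal{G}(\mathbf{B})^{\bowtie}}$, i.e. $(a,b),(c,d)\in\mathsf{G}_2(\mathbf{T})$ implies $(\Box(a\to c),\,a\wedge d)\in\mathsf{G}_2(\mathbf{T})$.
   Context: A topological Boolean algebra (TBA) is an algebra $\mathbf{B}=\langle B;\vee,\wedge,\to,\bot,\Box\rangle$ whose reduct is a Boolean algebra (top $1$, $\neg a:=a\to\bot$) with $\Box 1=1$, $\Box(a\wedge b)=\Box a\wedge\Box b$, $\Box a\le a$, $\Box a\le\Box\Box a$; $\Diamond a:=\neg\Box\neg a$. $\mathsf{G}(\mathbf{B})=\{a\in B:\Box a=a\}$; $\mathcal{G}(\mathbf{B})$ is the Heyting algebra on $\mathsf{G}(\mathbf{B})$ with $\vee,\wedge,\bot$ of $\mathbf{B}$ and $a\to_{\mathcal{G}(\mathbf{B})}b:=\Box(a\to b)$; $\mathcal{G}(\mathbf{B})^{\bowtie}$ is its full twist-structure, on $\mathsf{G}(\mathbf{B})^2$, with $(a,b)\to(c,d)=(a\to_{\mathcal{G}(\mathbf{B})}c,\ a\wedge d)$. A filter is open if closed under $\Box$; an ideal is closed if closed under $\Diamond$. $Tw(\mathbf{B},\nabla,\Delta)=\{(a,b)\in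 B\times B: a\vee b\in\nabla,\ a\wedge b\in\Delta\}$. For $\mathbf{T}=Tw(\mathbf{B},\nabla,\Delta)$: $\mathsf{G}_2(\mathbf{T})=\{(a,b)\in\mathbf{T}:\Box a=a,\ \Box b=b\}$, $\Gamma(\mathbf{T})=\pi_1(\mathsf{G}_2(\mathbf{T}))$ ($\pi_1$ first projection), $\Lambda(\mathbf{B},\nabla)=\{a\in\mathsf{G}(\mathbf{B}): a\vee\Box\neg a\in\nabla\}$. -}

module Defs where

open import Level using (Level; _⊔_) renaming (suc to lsuc)
open import Algebra.Lattice.Bundles using (BooleanAlgebra)
open import Data.Product using (_×_; _,_)

record TBA (c ℓ : Level) : Set (lsuc (c ⊔ ℓ)) where
  field
    boolAlg : BooleanAlgebra c ℓ
  open BooleanAlgebra boolAlg public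
  infixr 5 _⇒_
  _≤_ : Carrier → Carrier → Set ℓ
  a ≤ b = (a ∧ b) ≈ a
  field
    _⇒_    : Carrier → Carrier → Carrier
    ⇒-def  : ∀ a b → (a ⇒ b) ≈ (¬ a ∨ b)
    □      : Carrier → Carrier
    □-cong : ∀ {a b} → a ≈ b → □ a ≈ □ b
    □-top  : □ ⊤ ≈ ⊤
    □-∧    : ∀ a b → □ (a ∧ b) ≈ (□ a ∧ □ b)
    □-defl : ∀ a → □ a ≤ a
    □-4    : ∀ a → □ a ≤ □ (□ a)
  ◇ : Carrier → Carrier
  ◇ a = ¬ □ (¬ a)

module _ {c ℓ : Level} (B : TBA c ℓ) where
  open TBA B

  Subset : Set (lsuc (c ⊔ ℓ))
  Subset = Carrier → Set (c ⊔ ℓ)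

  record IsFilter (F : Subset) : Set (c ⊔ ℓ) where
    field
      resp   : ∀ {a b} → a ≈ b → F a → F b
      has-⊤  : F ⊤
      up     : ∀ {a b} → a ≤ b → F a → F b
      meet   : ∀ {a b} → F a → F b → F (a ∧ b)

  record IsIdeal (I : Subset) : Set (c ⊔ ℓ) where
    field
      resp   : ∀ {a b} → a ≈ b → I a → I b
      has-⊥  : I ⊥
      down   : ∀ {a b} → a ≤ b → I b → I a
      join   : ∀ {a b} → I a → I b → I (a ∨ b)

  IsOpenFilter : Subset → Set (c ⊔ ℓ)
  IsOpenFilter F = IsFilter F × (∀ {a} → F a → F (□ a))

  IsClosedIdeal : Subset → Set (c ⊔ ℓ)
  IsClosedIdeal I = IsIdeal I × (∀ {a} → I a → I (◇ a))

  InTw : Subset → Subset → Carrier → Carrier → Set (c ⊔ ℓ)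
  InTw ∇ Δ a b = ∇ (a ∨ b) × Δ (a ∧ b)

  InG₂ : Subset → Subset → Carrier → Carrier → Set (c ⊔ ℓ)
  InG₂ ∇ Δ a b = InTw ∇ Δ a b × (□ a ≈ a) × (□ b ≈ b)

  InΓ : Subset → Subset → Carrier → Set (c ⊔ ℓ)
  InΓ ∇ Δ a = Data.Product.Σ Carrier (λ b → InG₂ ∇ Δ a b)

  InΛ : Subset → Carrier → Set (c ⊔ ℓ)
  InΛ ∇ a = (□ a ≈ a) × ∇ (a ∨ □ (¬ a))

module Submission where

-- If every a ∈ Γ satisfies
-- a ∨ □¬a ∈ ∇, then for (a,b),(c,d) ∈ G₂ the element (a ∨ □¬a) ∧ (c ∨ d) of ∇
-- lies below □(a → c) ∨ (a ∧ d), because a ∧ c = □(a ∧ c) and □¬a are both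
-- below □(a → c); and □(a → c) ∧ a ∧ d lies below c ∧ d ∈ Δ.  Conversely,
-- (⊥,⊤) ∈ G₂, and closing (a,b),(⊥,⊤) under the twisted implication yields
-- the pair (□¬a, a), whose join a ∨ □¬a must then be in ∇.

open import Defs
open import Level using (Level)
open import Data.Product using (_,_; proj₁; proj₂)
open import Function.Bundles using (_⇔_; mk⇔)
import Algebra.Lattice.Properties.Lattice as LatticeProperties
import Algebra.Lattice.Properties.BooleanAlgebra as BooleanAlgebraProperties
import Relation.Binary.Lattice as OrderLattice
import Relation.Binary.Lattice.Properties.MeetSemilattice as MeetSemilatticeProperties
import Relation.Binary.Lattice.Properties.JoinSemilattice as JoinSemilatticeProperties
import Relation.Binary.Reasoning.PartialOrder as PartialOrderReasoning

module TBAProperties {c ℓ : Level} (B : TBA c ℓ) where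
  open TBA B
  open BooleanAlgebraProperties boolAlg
    using (∧-zeroˡ; ∨-identityʳ; ∧-identityʳ)
  open LatticeProperties lattice using (∨-∧-orderTheoreticLattice)
  open OrderLattice.Lattice ∨-∧-orderTheoreticLattice
    using (poset; meetSemilattice; joinSemilattice; antisym; ∨-least; ∧-greatest)
    renaming ( _≤_ to _⊑_; refl to ⊑-refl; reflexive to ⊑-reflexive; trans to ⊑-trans
             ; x≤x∨y to x⊑x∨y; y≤x∨y to y⊑x∨y; x∧y≤x to x∧y⊑x; x∧y≤y to x∧y⊑y)
  open MeetSemilatticeProperties meetSemilattice using (∧-monotonic)
  open JoinSemilatticeProperties joinSemilattice using (∨-monotonic)
  open PartialOrderReasoning poset

  -- The lattice order x ⊑ y is x ≈ x ∧ y, while the TBA order x ≤ y is x ∧ y ≈ x.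
  ⊑⇒≤ : ∀ {x y} → x ⊑ y → x ≤ y
  ⊑⇒≤ = sym

  □x⊑x : ∀ x → □ x ⊑ x
  □x⊑x x = sym (□-defl x)

  □-mono : ∀ {x y} → x ⊑ y → □ x ⊑ □ y
  □-mono {x} {y} x⊑y = trans (□-cong x⊑y) (□-∧ x y)

  □-idem : ∀ x → □ (□ x) ≈ □ x
  □-idem x = antisym (□x⊑x (□ x)) (sym (□-4 x))

  ⊥⊑x : ∀ x → ⊥ ⊑ x
  ⊥⊑x x = sym (∧-zeroˡ x)

  □-zero : □ ⊥ ≈ ⊥
  □-zero = antisym (□x⊑x ⊥) (⊥⊑x (□ ⊥))

  □-fixed-∧ : ∀ {x y} → □ x ≈ x → □ y ≈ y → □ (x ∧ y) ≈ x ∧ y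
  □-fixed-∧ {x} {y} □x≈x □y≈y = trans (□-∧ x y) (∧-cong □x≈x □y≈y)

  x⇒y∧x⊑y : ∀ x y → (x ⇒ y) ∧ x ⊑ y
  x⇒y∧x⊑y x y = begin
    (x ⇒ y) ∧ x            ≈⟨ ∧-congʳ (⇒-def x y) ⟩
    (¬ x ∨ y) ∧ x          ≈⟨ ∧-distribʳ-∨ x (¬ x) y ⟩
    (¬ x ∧ x) ∨ (y ∧ x)    ≤⟨ ∨-least (⊑-trans (⊑-reflexive (∧-complementˡ x)) (⊥⊑x y)) (x∧y⊑x y x) ⟩
    y                      ∎

  ¬x⊑x⇒y : ∀ x y → ¬ x ⊑ (x ⇒ y)
  ¬x⊑x⇒y x y = begin
    ¬ x       ≤⟨ x⊑x∨y (¬ x) y ⟩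
    ¬ x ∨ y   ≈⟨ ⇒-def x y ⟨
    x ⇒ y     ∎

  y⊑x⇒y : ∀ x y → y ⊑ (x ⇒ y)
  y⊑x⇒y x y = begin
    y         ≤⟨ y⊑x∨y (¬ x) y ⟩
    ¬ x ∨ y   ≈⟨ ⇒-def x y ⟨
    x ⇒ y     ∎

  x∧y⊑□[x⇒y] : ∀ {x y} → □ x ≈ x → □ y ≈ y → x ∧ y ⊑ □ (x ⇒ y)
  x∧y⊑□[x⇒y] {x} {y} □x≈x □y≈y = begin
    x ∧ y        ≈⟨ □-fixed-∧ □x≈x □y≈y ⟨
    □ (x ∧ y)    ≤⟨ □-mono (⊑-trans (x∧y⊑y x y) (y⊑x⇒y x y)) ⟩
    □ (x ⇒ y)    ∎

  [x∨□¬x]∧[y∨z]⊑□[x⇒y]∨x∧z : ∀ {x y} z → □ x ≈ x → □ y ≈ y →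
    (x ∨ □ (¬ x)) ∧ (y ∨ z) ⊑ □ (x ⇒ y) ∨ (x ∧ z)
  [x∨□¬x]∧[y∨z]⊑□[x⇒y]∨x∧z {x} {y} z □x≈x □y≈y = begin
    (x ∨ □ (¬ x)) ∧ (y ∨ z)                  ≈⟨ ∧-distribʳ-∨ (y ∨ z) x (□ (¬ x)) ⟩
    (x ∧ (y ∨ z)) ∨ (□ (¬ x) ∧ (y ∨ z))      ≤⟨ ∨-monotonic (⊑-reflexive (∧-distribˡ-∨ x y z))
                                                            (x∧y⊑x (□ (¬ x)) (y ∨ z)) ⟩
    ((x ∧ y) ∨ (x ∧ z)) ∨ □ (¬ x)            ≤⟨ ∨-least (∨-monotonic (x∧y⊑□[x⇒y] □x≈x □y≈y) ⊑-refl)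
                                                        (⊑-trans (□-mono (¬x⊑x⇒y x y)) (x⊑x∨y _ _)) ⟩
    □ (x ⇒ y) ∨ (x ∧ z)                      ∎

  □[x⇒y]∧[x∧z]⊑y∧z : ∀ x y z → □ (x ⇒ y) ∧ (x ∧ z) ⊑ y ∧ z
  □[x⇒y]∧[x∧z]⊑y∧z x y z = ∧-greatest
    (begin
      □ (x ⇒ y) ∧ (x ∧ z)   ≤⟨ ∧-monotonic (□x⊑x (x ⇒ y)) (x∧y⊑x x z) ⟩
      (x ⇒ y) ∧ x           ≤⟨ x⇒y∧x⊑y x y ⟩
      y                     ∎)
    (begin
      □ (x ⇒ y) ∧ (x ∧ z)   ≤⟨ x∧y⊑y _ _ ⟩
      x ∧ z                 ≤⟨ x∧y⊑y x z ⟩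
      z                     ∎)

  □[x⇒⊥]∨x∧⊤≈x∨□¬x : ∀ x → □ (x ⇒ ⊥) ∨ (x ∧ ⊤) ≈ x ∨ □ (¬ x)
  □[x⇒⊥]∨x∧⊤≈x∨□¬x x = begin-equality
    □ (x ⇒ ⊥) ∨ (x ∧ ⊤)   ≈⟨ ∨-cong (□-cong (⇒-def x ⊥)) (∧-identityʳ x) ⟩
    □ (¬ x ∨ ⊥) ∨ x       ≈⟨ ∨-congʳ (□-cong (∨-identityʳ (¬ x))) ⟩
    □ (¬ x) ∨ x           ≈⟨ ∨-comm (□ (¬ x)) x ⟩
    x ∨ □ (¬ x)           ∎

module TwistStructure {c ℓ : Level} (B : TBA c ℓ) (∇ Δ : Subset B)
  (∇-filter : IsFilter B ∇) (Δ-ideal : IsIdeal B Δ) where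
  open TBA B
  open TBAProperties B
  open BooleanAlgebraProperties boolAlg using (∧-zeroˡ; ∨-identityˡ)
  module ∇ = IsFilter ∇-filter
  module Δ = IsIdeal Δ-ideal

  Γ⊆Λ : Set _
  Γ⊆Λ = ∀ a → InΓ B ∇ Δ a → InΛ B ∇ a

  G₂-closed-under-⇒ : Set _
  G₂-closed-under-⇒ = ∀ a b c d → InG₂ B ∇ Δ a b → InG₂ B ∇ Δ c d →
    InG₂ B ∇ Δ (□ (a ⇒ c)) (a ∧ d)

  ⊥⊤∈G₂ : InG₂ B ∇ Δ ⊥ ⊤
  ⊥⊤∈G₂ = ( ∇.resp (sym (∨-identityˡ ⊤)) ∇.has-⊤
          , Δ.resp (sym (∧-zeroˡ ⊤)) Δ.has-⊥ )
        , □-zero , □-top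

  Γ⊆Λ⇒G₂-closed-under-⇒ : Γ⊆Λ → G₂-closed-under-⇒
  Γ⊆Λ⇒G₂-closed-under-⇒ Γ-in-Λ a b c d ab∈G₂@(_ , □a≈a , _) ((c∨d∈∇ , c∧d∈Δ) , □c≈c , □d≈d) =
    (join∈∇ , meet∈Δ) , □-idem (a ⇒ c) , □-fixed-∧ □a≈a □d≈d
    where
    a∨□¬a∈∇ : ∇ (a ∨ □ (¬ a))
    a∨□¬a∈∇ = proj₂ (Γ-in-Λ a (b , ab∈G₂))

    join∈∇ : ∇ (□ (a ⇒ c) ∨ (a ∧ d))
    join∈∇ = ∇.up (⊑⇒≤ ([x∨□¬x]∧[y∨z]⊑□[x⇒y]∨x∧z d □a≈a □c≈c)) (∇.meet a∨□¬a∈∇ c∨d∈∇)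

    meet∈Δ : Δ (□ (a ⇒ c) ∧ (a ∧ d))
    meet∈Δ = Δ.down (⊑⇒≤ (□[x⇒y]∧[x∧z]⊑y∧z a c d)) c∧d∈Δ

  G₂-closed-under-⇒⇒Γ⊆Λ : G₂-closed-under-⇒ → Γ⊆Λ
  G₂-closed-under-⇒⇒Γ⊆Λ closed a (b , ab∈G₂@(_ , □a≈a , _)) =
    □a≈a , ∇.resp (□[x⇒⊥]∨x∧⊤≈x∨□¬x a) (proj₁ (proj₁ (closed a b ⊥ ⊤ ab∈G₂ ⊥⊤∈G₂)))

lemma3p1p4 : {c ℓ : Level} (B : TBA c ℓ) (∇ Δ : Subset B) →
    IsOpenFilter B ∇ → IsClosedIdeal B Δ →
    ((∀ a → InΓ B ∇ Δ a → InΛ B ∇ a)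
    ⇔
    (∀ a b c' d → InG₂ B ∇ Δ a b → InG₂ B ∇ Δ c' d →
    InG₂ B ∇ Δ (TBA.□ B (TBA._⇒_ B a c')) (TBA._∧_ B a d)))
lemma3p1p4 B ∇ Δ (∇-filter , _) (Δ-ideal , _) =
  mk⇔ Γ⊆Λ⇒G₂-closed-under-⇒ G₂-closed-under-⇒⇒Γ⊆Λ
  where open TwistStructure B ∇ Δ ∇-filter Δ-ideal
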